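{- Let $p$ be a prime and let $f:\mathbb{F}_p\to\{0,\pm1\}$ be a function with $f(x)=0$ if and only if $x=0$, such that $f\star f=\chi\star\chi$. Then $f=\chi$ or $f=-\chi$.
   Context: $\chi:\mathbb{F}_p\to\{0,\pm1\}$ is the quadratic character: $\chi(0)=0$, $\chi(x)=1$ if $x$ is a nonzero square in $\mathbb{F}_p$, and $\chi(x)=-1$ otherwise. For functions $f,g$ on an abelian group $A$, the convolution is $(f\star g)(b)=\sum_{a\in A}f(b-a)g(a)$. -}

module Defs where

open import Data.Nat as ℕ using (ℕ; NonZero)
open import Data.Nat.DivMod using (_mod_)
open import Data.Fin as Fin using (Fin; toℕ)
open import Data.Fin.Properties using (any?; _≟_)
open import Data.Integer as ℤ using (ℤ; 0ℤ; 1ℤ; -1ℤ)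
open import Data.Product using (∃; _×_)
open import Relation.Nullary using (Dec; yes; no; ¬_)
open import Relation.Binary.PropositionalEquality using (_≡_)
open import Data.Vec.Functional using (foldr)

module _ (p : ℕ) .{{_ : NonZero p}} where

  _⊕_ : Fin p → Fin p → Fin p
  a ⊕ b = (toℕ a ℕ.+ toℕ b) mod p

  _⊗_ : Fin p → Fin p → Fin p
  a ⊗ b = (toℕ a ℕ.* toℕ b) mod p

  _⊖_ : Fin p → Fin p → Fin p
  a ⊖ b = (toℕ a ℕ.+ (p ℕ.∸ toℕ b)) mod p

  zeroF : Fin p
  zeroF = 0 mod p

  IsSquare : Fin p → Set
  IsSquare x = ∃ λ y → y ⊗ y ≡ x

  isSquare? : (x : Fin p) → Dec (IsSquare x)
  isSquare? x = any? (λ y → (y ⊗ y) ≟ x)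

  χ : Fin p → ℤ
  χ x with x ≟ zeroF
  ... | yes _ = 0ℤ
  ... | no  _ with isSquare? x
  ...   | yes _ = 1ℤ
  ...   | no  _ = -1ℤ

  Σ : (Fin p → ℤ) → ℤ
  Σ h = foldr ℤ._+_ 0ℤ h

  _⋆_ : (Fin p → ℤ) → (Fin p → ℤ) → Fin p → ℤ
  (f ⋆ g) b = Σ (λ a → f (b ⊖ a) ℤ.* g a)

module Submission where

-- Write f = s + d and χ = s − d, where s = (f + χ)/2 and d = (f − χ)/2 again take values
-- in {0, ±1} and vanish at 0. Then f ⋆ f − χ ⋆ χ = 4 s ⋆ d, so s ⋆ d = 0 in the group ring
-- ℤ[ℤ/p], and it suffices to show that s or d vanishes. Modulo the constant functions ℤN
-- the group ring is ℤ[ζₚ], where u = z − 1 generates a prime of residue field 𝔽ₚ, detected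
-- by the augmentation ε. From s ⋆ d = 0 and Euclid's lemma applied to ε, the u-adic
-- valuation of s or of d can be raised at every step, so one of them becomes divisible by
-- uᵖ. As uᵖ ≡ 0 (mod p) by Frobenius, that function is constant mod p, hence ≡ 0 mod p since
-- it vanishes at 0, hence 0 since its values lie in {0, ±1}.

open import Defs
open import Data.Nat using (ℕ)
open import Data.Nat.Primality using (Prime; prime⇒nonZero)
open import Data.Fin using (Fin)
open import Data.Integer using (ℤ; 0ℤ; 1ℤ; -1ℤ; -_)
open import Data.Sum using (_⊎_)
open import Data.Product using (_×_)
open import Function.Bundles using (_⇔_)
open import Relation.Binary.PropositionalEquality using (_≡_)

import Data.Integer.Properties as ℤ
import Data.Nat.Properties as ℕ
open import Algebra.Bundles using (CommutativeSemiring)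
import Algebra.Properties.CommutativeSemigroup as CommutativeSemigroupProperties
open import Algebra.Properties.AbelianGroup ℤ.+-0-abelianGroup using (identityʳ-unique)
import Algebra.Properties.Semiring.Exp as SemiringExp
open import Algebra.Properties.Semiring.Sum ℤ.+-*-semiring
  using (sum; sum-cong-≗; sum-replicate-zero; ∑-distrib-+; ∑-comm; sum-permute; *-distribˡ-sum; *-distribʳ-sum)
open import Algebra.Structures.Biased using (IsCommutativeSemiringˡ)
open import Data.Empty using (⊥-elim)
open import Data.Fin using (toℕ; fromℕ; zero; suc)
open import Data.Fin.Permutation using (permutation)
open import Data.Fin.Properties using (_≟_; toℕ-injective; toℕ-fromℕ<; toℕ<n; toℕ-fromℕ)
open import Data.Integer using (_+_; _*_; _-_; +_; _/ℕ_) renaming (∣_∣ to abs)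
open import Data.Integer.Divisibility.Signed
  using (_∣_; divides; ∣m∣n⇒∣m+n; ∣m+n∣m⇒∣n; ∣n⇒∣m*n; ∣m⇒∣m*n; ∣m⇒∣-m; ∣ᵤ⇒∣; ∣⇒∣ᵤ)
open import Data.Integer.Tactic.RingSolver using (solve-∀)
open import Data.Nat as ℕ using (NonZero; zero; suc; _%_; _∸_; _!)
open import Data.Nat.Combinatorics using (_C_; nCk≡n!/k![n-k]!; k![n∸k]!∣n!; nCn≡1)
open import Data.Nat.Divisibility using ()
  renaming (_∣_ to _ℕ∣_; ∣1⇒≡1 to ℕ∣1⇒≡1; ∣⇒≤ to ℕ∣⇒≤; m∣m*n to ℕm∣m*n)
open import Data.Nat.DivMod using (_mod_; %-distribˡ-+; m%n%n≡m%n; m<n⇒m%n≡m; [m+n]%n≡m%n; n%n≡0; m/n*n≡m)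
open import Data.Nat.Primality using (¬prime[1]; euclidsLemma)
open import Data.Product using (∃; ∃₂; _,_; proj₁; proj₂)
import Data.Sum as Sum
open import Data.Sum using (inj₁; inj₂; [_,_]; [_,_]′)
open import Function using (_∘_; const; id)
open import Function.Bundles using (Equivalence; mk⇔)
open import Function.Properties.Equivalence using () renaming (sym to ⇔-sym; trans to ⇔-trans)
open import Relation.Binary.PropositionalEquality using (refl; sym; trans; cong; cong₂; subst; _≢_; module ≡-Reasoning)
import Relation.Binary.Reasoning.Setoid as SetoidReasoning
open import Relation.Binary.Structures using (IsEquivalence)
open import Relation.Nullary using (¬_; Dec; yes; no)

-- Arithmetic of ℤ/p on Fin p

module Modular (p : ℕ) .{{_ : NonZero p}} where

  infixl 6 _+ₚ_ _-ₚ_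

  _+ₚ_ _-ₚ_ : Fin p → Fin p → Fin p
  _+ₚ_ = _⊕_ p
  _-ₚ_ = _⊖_ p

  0ₚ 1ₚ : Fin p
  0ₚ = zeroF p
  1ₚ = 1 mod p

  toℕ-mod : ∀ m → toℕ (m mod p) ≡ m % p
  toℕ-mod m = toℕ-fromℕ< _

  mod-cong : ∀ {m n} → m % p ≡ n % p → m mod p ≡ n mod p
  mod-cong eq = toℕ-injective (trans (toℕ-mod _) (trans eq (sym (toℕ-mod _))))

  toℕ-mod-inverse : ∀ x → toℕ x mod p ≡ x
  toℕ-mod-inverse x = toℕ-injective (trans (toℕ-mod _) (m<n⇒m%n≡m (toℕ<n x)))

  mod-absorbˡ : ∀ m n → (toℕ (m mod p) ℕ.+ n) mod p ≡ (m ℕ.+ n) mod p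
  mod-absorbˡ m n = mod-cong (begin
    (toℕ (m mod p) ℕ.+ n) % p     ≡⟨ cong (λ k → (k ℕ.+ n) % p) (toℕ-mod m) ⟩
    (m % p ℕ.+ n) % p             ≡⟨ %-distribˡ-+ (m % p) n p ⟩
    (m % p % p ℕ.+ n % p) % p     ≡⟨ cong (λ k → (k ℕ.+ n % p) % p) (m%n%n≡m%n m p) ⟩
    (m % p ℕ.+ n % p) % p         ≡⟨ %-distribˡ-+ m n p ⟨
    (m ℕ.+ n) % p                 ∎)
    where open ≡-Reasoning

  mod-absorbʳ : ∀ m n → (m ℕ.+ toℕ (n mod p)) mod p ≡ (m ℕ.+ n) mod p
  mod-absorbʳ m n = begin
    (m ℕ.+ toℕ (n mod p)) mod p   ≡⟨ cong (_mod p) (ℕ.+-comm m _) ⟩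
    (toℕ (n mod p) ℕ.+ m) mod p   ≡⟨ mod-absorbˡ n m ⟩
    (n ℕ.+ m) mod p               ≡⟨ cong (_mod p) (ℕ.+-comm n m) ⟩
    (m ℕ.+ n) mod p               ∎
    where open ≡-Reasoning

  mod-distrib-+ : ∀ m n → m mod p +ₚ n mod p ≡ (m ℕ.+ n) mod p
  mod-distrib-+ m n = trans (mod-absorbˡ m _) (mod-absorbʳ m n)

  +ₚ-comm : ∀ x y → x +ₚ y ≡ y +ₚ x
  +ₚ-comm x y = cong (_mod p) (ℕ.+-comm (toℕ x) (toℕ y))

  +ₚ-assoc : ∀ x y w → x +ₚ y +ₚ w ≡ x +ₚ (y +ₚ w)
  +ₚ-assoc x y w = begin
    x +ₚ y +ₚ w                                 ≡⟨ mod-absorbˡ (toℕ x ℕ.+ toℕ y) (toℕ w) ⟩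
    (toℕ x ℕ.+ toℕ y ℕ.+ toℕ w) mod p           ≡⟨ cong (_mod p) (ℕ.+-assoc (toℕ x) _ _) ⟩
    (toℕ x ℕ.+ (toℕ y ℕ.+ toℕ w)) mod p         ≡⟨ mod-absorbʳ (toℕ x) (toℕ y ℕ.+ toℕ w) ⟨
    x +ₚ (y +ₚ w)                               ∎
    where open ≡-Reasoning

  +ₚ-identityʳ : ∀ x → x +ₚ 0ₚ ≡ x
  +ₚ-identityʳ x = trans (mod-absorbʳ (toℕ x) 0) (trans (cong (_mod p) (ℕ.+-identityʳ _)) (toℕ-mod-inverse x))

  [toℕx+p]mod≡x : ∀ x → (toℕ x ℕ.+ p) mod p ≡ x
  [toℕx+p]mod≡x x = trans (mod-cong ([m+n]%n≡m%n (toℕ x) p)) (toℕ-mod-inverse x)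

  x-ₚy+ₚy≡x : ∀ x y → x -ₚ y +ₚ y ≡ x
  x-ₚy+ₚy≡x x y = begin
    x -ₚ y +ₚ y
      ≡⟨ mod-absorbˡ (toℕ x ℕ.+ (p ℕ.∸ toℕ y)) (toℕ y) ⟩
    (toℕ x ℕ.+ (p ℕ.∸ toℕ y) ℕ.+ toℕ y) mod p
      ≡⟨ cong (_mod p) (ℕ.+-assoc (toℕ x) _ _) ⟩
    (toℕ x ℕ.+ ((p ℕ.∸ toℕ y) ℕ.+ toℕ y)) mod p
      ≡⟨ cong (λ k → (toℕ x ℕ.+ k) mod p) (ℕ.m∸n+n≡m (ℕ.<⇒≤ (toℕ<n y))) ⟩
    (toℕ x ℕ.+ p) mod p
      ≡⟨ [toℕx+p]mod≡x x ⟩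
    x ∎
    where open ≡-Reasoning

  x+ₚy-ₚy≡x : ∀ x y → x +ₚ y -ₚ y ≡ x
  x+ₚy-ₚy≡x x y = begin
    x +ₚ y -ₚ y
      ≡⟨ mod-absorbˡ (toℕ x ℕ.+ toℕ y) (p ℕ.∸ toℕ y) ⟩
    (toℕ x ℕ.+ toℕ y ℕ.+ (p ℕ.∸ toℕ y)) mod p
      ≡⟨ cong (_mod p) (ℕ.+-assoc (toℕ x) _ _) ⟩
    (toℕ x ℕ.+ (toℕ y ℕ.+ (p ℕ.∸ toℕ y))) mod p
      ≡⟨ cong (λ k → (toℕ x ℕ.+ k) mod p) (ℕ.m+[n∸m]≡n (ℕ.<⇒≤ (toℕ<n y))) ⟩
    (toℕ x ℕ.+ p) mod p
      ≡⟨ [toℕx+p]mod≡x x ⟩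
    x ∎
    where open ≡-Reasoning

  -ₚ-unique : ∀ {x y w} → x ≡ w +ₚ y → x -ₚ y ≡ w
  -ₚ-unique {y = y} {w} refl = x+ₚy-ₚy≡x w y

  x-ₚ[x-ₚy]≡y : ∀ x y → x -ₚ (x -ₚ y) ≡ y
  x-ₚ[x-ₚy]≡y x y = -ₚ-unique (sym (trans (+ₚ-comm y (x -ₚ y)) (x-ₚy+ₚy≡x x y)))

  x-ₚ[y+ₚw]≡x-ₚw-ₚy : ∀ x y w → x -ₚ (y +ₚ w) ≡ x -ₚ w -ₚ y
  x-ₚ[y+ₚw]≡x-ₚw-ₚy x y w = -ₚ-unique (sym (begin
    x -ₚ w -ₚ y +ₚ (y +ₚ w)    ≡⟨ +ₚ-assoc (x -ₚ w -ₚ y) y w ⟨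
    x -ₚ w -ₚ y +ₚ y +ₚ w      ≡⟨ cong (_+ₚ w) (x-ₚy+ₚy≡x (x -ₚ w) y) ⟩
    x -ₚ w +ₚ w                ≡⟨ x-ₚy+ₚy≡x x w ⟩
    x                          ∎))
    where open ≡-Reasoning

  x-ₚ0≡x : ∀ x → x -ₚ 0ₚ ≡ x
  x-ₚ0≡x x = -ₚ-unique (sym (+ₚ-identityʳ x))

  suc-mod : ∀ n → n mod p +ₚ 1ₚ ≡ suc n mod p
  suc-mod n = trans (mod-distrib-+ n 1) (cong (_mod p) (ℕ.+-comm n 1))

  +ₚ1-induction : (P : Fin p → Set) → P 0ₚ → (∀ x → P x → P (x +ₚ 1ₚ)) → ∀ x → P x
  +ₚ1-induction P P0 step x = subst P (toℕ-mod-inverse x) (from-ℕ (toℕ x))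
    where
    from-ℕ : ∀ n → P (n mod p)
    from-ℕ zero    = P0
    from-ℕ (suc n) = subst P (suc-mod n) (step _ (from-ℕ n))

-- Finite sums

δ : ∀ {n} → Fin n → Fin n → ℤ
δ i k with k ≟ i
... | yes _ = 1ℤ
... | no  _ = 0ℤ

δ-diag : ∀ {n} (i : Fin n) → δ i i ≡ 1ℤ
δ-diag i with i ≟ i
... | yes _  = refl
... | no i≢i = ⊥-elim (i≢i refl)

δ-off : ∀ {n} {i k : Fin n} → k ≢ i → δ i k ≡ 0ℤ
δ-off {i = i} {k} k≢i with k ≟ i
... | yes k≡i = ⊥-elim (k≢i k≡i)
... | no  _   = refl

δ-cong : ∀ {n} {i k i′ k′ : Fin n} → (k ≡ i) ⇔ (k′ ≡ i′) → δ i k ≡ δ i′ k′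
δ-cong {i = i} {k} {i′} {k′} k≡i⇔k′≡i′ with k ≟ i | k′ ≟ i′
... | yes _   | yes _    = refl
... | no  _   | no  _    = refl
... | yes k≡i | no k′≢i′ = ⊥-elim (k′≢i′ (Equivalence.to k≡i⇔k′≡i′ k≡i))
... | no k≢i  | yes k′≡i′ = ⊥-elim (k≢i (Equivalence.from k≡i⇔k′≡i′ k′≡i′))

δ-sym : ∀ {n} (i k : Fin n) → δ i k ≡ δ k i
δ-sym i k = δ-cong (mk⇔ sym sym)

sum-δ* : ∀ {n} (i : Fin n) (g : Fin n → ℤ) → sum (λ k → δ i k * g k) ≡ g i
sum-δ* {suc n} zero g = begin
  1ℤ * g zero + sum (λ k → 0ℤ * g (suc k))
    ≡⟨ cong₂ _+_ (ℤ.*-identityˡ (g zero)) (sum-cong-≗ {n} (ℤ.*-zeroˡ ∘ g ∘ suc)) ⟩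
  g zero + sum {n} (λ _ → 0ℤ)
    ≡⟨ cong (λ t → g zero + t) (sum-replicate-zero n) ⟩
  g zero + 0ℤ
    ≡⟨ ℤ.+-identityʳ (g zero) ⟩
  g zero ∎
  where open ≡-Reasoning
sum-δ* {suc n} (suc i) g = begin
  0ℤ * g zero + sum (λ k → δ (suc i) (suc k) * g (suc k))
    ≡⟨ cong₂ _+_ (ℤ.*-zeroˡ (g zero)) (sum-cong-≗ {n} (λ k → cong (_* g (suc k)) (δ-suc k))) ⟩
  0ℤ + sum (λ k → δ i k * g (suc k))
    ≡⟨ ℤ.+-identityˡ _ ⟩
  sum (λ k → δ i k * g (suc k))
    ≡⟨ sum-δ* i (g ∘ suc) ⟩
  g (suc i) ∎
  where
  open ≡-Reasoning
  δ-suc : ∀ k → δ (suc i) (suc k) ≡ δ i k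
  δ-suc k with k ≟ i
  ... | yes _ = refl
  ... | no  _ = refl

sum-const : ∀ n c → sum {n} (const c) ≡ + n * c
sum-const zero    c = refl
sum-const (suc n) c = begin
  c + sum {n} (const c)   ≡⟨ cong (λ t → c + t) (sum-const n c) ⟩
  c + + n * c             ≡⟨ cong (_+ + n * c) (ℤ.*-identityˡ c) ⟨
  1ℤ * c + + n * c        ≡⟨ ℤ.*-distribʳ-+ c 1ℤ (+ n) ⟨
  + suc n * c             ∎
  where open ≡-Reasoning

sum-neg : ∀ {n} (g : Fin n → ℤ) → sum (λ k → - g k) ≡ - sum g
sum-neg g = begin
  sum (λ k → - g k)       ≡⟨ sum-cong-≗ (λ k → sym (ℤ.-1*i≡-i (g k))) ⟩
  sum (λ k → -1ℤ * g k)   ≡⟨ *-distribˡ-sum -1ℤ g ⟨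
  -1ℤ * sum g             ≡⟨ ℤ.-1*i≡-i (sum g) ⟩
  - sum g                 ∎
  where open ≡-Reasoning

∣-sum : ∀ {n d} (F : Fin n → ℤ) → (∀ k → d ∣ F k) → d ∣ sum F
∣-sum {zero}  F d∣F = divides 0ℤ refl
∣-sum {suc n} F d∣F = ∣m∣n⇒∣m+n (d∣F zero) (∣-sum (F ∘ suc) (d∣F ∘ suc))

∣-sum-but-two : ∀ {n d} (F : Fin n → ℤ) {i j} → i ≢ j →
                (∀ k → k ≢ i → k ≢ j → d ∣ F k) → d ∣ sum F - (F i + F j)
∣-sum-but-two {n} {d} F {i} {j} i≢j d∣F = subst (d ∣_) sum[F-E]≡sumF-[Fi+Fj] (∣-sum (λ k → F k - E k) d∣F-E)
  where
  E : Fin n → ℤ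
  E k = δ i k * F i + δ j k * F j
  sum[F-E]≡sumF-[Fi+Fj] : sum (λ k → F k - E k) ≡ sum F - (F i + F j)
  sum[F-E]≡sumF-[Fi+Fj] = begin
    sum (λ k → F k - E k)     ≡⟨ ∑-distrib-+ F (λ k → - E k) ⟩
    sum F + sum (λ k → - E k) ≡⟨ cong (λ t → sum F + t) (sum-neg E) ⟩
    sum F - sum E             ≡⟨ cong (λ t → sum F - t) (trans (∑-distrib-+ (λ k → δ i k * F i) (λ k → δ j k * F j))
                                                                (cong₂ _+_ (sum-δ* i (const (F i))) (sum-δ* j (const (F j))))) ⟩
    sum F - (F i + F j)       ∎
    where open ≡-Reasoning
  x-[1x+0y]≡0 : ∀ x y → x - (1ℤ * x + 0ℤ * y) ≡ 0ℤ
  x-[1x+0y]≡0 = solve-∀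
  y-[0x+1y]≡0 : ∀ x y → y - (0ℤ * x + 1ℤ * y) ≡ 0ℤ
  y-[0x+1y]≡0 = solve-∀
  w-[0x+0y]≡w : ∀ x y w → w - (0ℤ * x + 0ℤ * y) ≡ w
  w-[0x+0y]≡w = solve-∀
  d∣F-E : ∀ k → d ∣ F k - E k
  d∣F-E k = by-cases k (k ≟ i) (k ≟ j)
    where
    by-cases : ∀ k → Dec (k ≡ i) → Dec (k ≡ j) → d ∣ F k - E k
    by-cases k (yes refl) _ = subst (d ∣_)
      (sym (trans (cong₂ (λ s t → F i - (s * F i + t * F j)) (δ-diag i) (δ-off i≢j)) (x-[1x+0y]≡0 (F i) (F j)))) (divides 0ℤ refl)
    by-cases k (no k≢i) (yes refl) = subst (d ∣_)
      (sym (trans (cong₂ (λ s t → F j - (s * F i + t * F j)) (δ-off k≢i) (δ-diag j)) (y-[0x+1y]≡0 (F i) (F j)))) (divides 0ℤ refl)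
    by-cases k (no k≢i) (no k≢j) = subst (d ∣_)
      (sym (trans (cong₂ (λ s t → F k - (s * F i + t * F j)) (δ-off k≢i) (δ-off k≢j)) (w-[0x+0y]≡w (F i) (F j) (F k))))
      (d∣F k k≢i k≢j)

-- Primes and values in {0, ±1}

prime∤! : ∀ {p m} → Prime p → m ℕ.< p → ¬ p ℕ∣ m !
prime∤! {m = zero}  pp _   p∣1 = ¬prime[1] (subst Prime (ℕ∣1⇒≡1 p∣1) pp)
prime∤! {m = suc m} pp m<p p∣m! with euclidsLemma (suc m) (m !) pp p∣m!
... | inj₁ p∣1+m = ℕ.<⇒≱ m<p (ℕ∣⇒≤ p∣1+m)
... | inj₂ p∣m!  = prime∤! pp (ℕ.<-trans (ℕ.n<1+n m) m<p) p∣m!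

prime∣binomial : ∀ {p k} → Prime p → 0 ℕ.< k → k ℕ.< p → p ℕ∣ p C k
prime∣binomial {p} {k} pp 0<k k<p =
  [ id , (λ p∣k![p-k]! → ⊥-elim ([ prime∤! pp k<p , prime∤! pp (ℕ.∸-monoʳ-< 0<k (ℕ.<⇒≤ k<p)) ]
                                     (euclidsLemma (k !) ((p ∸ k) !) pp p∣k![p-k]!))) ]
  (euclidsLemma (p C k) (k ! ℕ.* (p ∸ k) !) pp p∣pCk*k!*[p-k]!)
  where
  instance _ = ℕ._!*_!≢0 k (p ∸ k)
  p∣p! : p ℕ∣ p !
  p∣p! = subst (λ n → n ℕ∣ n !) (ℕ.suc-pred p {{prime⇒nonZero pp}}) (ℕm∣m*n (ℕ.pred p !))
  p∣pCk*k!*[p-k]! : p ℕ∣ (p C k) ℕ.* (k ! ℕ.* (p ∸ k) !)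
  p∣pCk*k!*[p-k]! = subst (p ℕ∣_) (sym (trans (cong (ℕ._* (k ! ℕ.* (p ∸ k) !)) (nCk≡n!/k![n-k]! (ℕ.<⇒≤ k<p)))
                                               (m/n*n≡m (k![n∸k]!∣n! (ℕ.<⇒≤ k<p))))) p∣p!

prime∣*⇒∣⊎∣ : ∀ {p} m n → Prime p → + p ∣ m * n → + p ∣ m ⊎ + p ∣ n
prime∣*⇒∣⊎∣ m n pp p∣mn =
  Sum.map ∣ᵤ⇒∣ ∣ᵤ⇒∣ (euclidsLemma (abs m) (abs n) pp (subst (_ ℕ∣_) (ℤ.abs-* m n) (∣⇒∣ᵤ p∣mn)))

Trit : ℤ → Set
Trit a = a ≡ 0ℤ ⊎ a ≡ 1ℤ ⊎ a ≡ -1ℤ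

prime∣trit⇒≡0 : ∀ {p a} → Prime p → + p ∣ a → Trit a → a ≡ 0ℤ
prime∣trit⇒≡0 pp p∣a (inj₁ a≡0)        = a≡0
prime∣trit⇒≡0 pp p∣a (inj₂ (inj₁ refl)) = ⊥-elim (¬prime[1] (subst Prime (ℕ∣1⇒≡1 (∣⇒∣ᵤ p∣a)) pp))
prime∣trit⇒≡0 pp p∣a (inj₂ (inj₂ refl)) = ⊥-elim (¬prime[1] (subst Prime (ℕ∣1⇒≡1 (∣⇒∣ᵤ p∣a)) pp))

half : ℤ → ℤ
half x = x /ℕ 2

sign-halves : ∀ {a c} → Trit a → Trit c → (a ≡ 0ℤ) ⇔ (c ≡ 0ℤ) →
              a ≡ half (a + c) + half (a - c) × c ≡ half (a + c) - half (a - c) ×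
              Trit (half (a + c)) × Trit (half (a - c))
sign-halves (inj₁ refl)        (inj₁ refl)        _ = refl , refl , inj₁ refl , inj₁ refl
sign-halves (inj₂ (inj₁ refl)) (inj₂ (inj₁ refl)) _ = refl , refl , inj₂ (inj₁ refl) , inj₁ refl
sign-halves (inj₂ (inj₁ refl)) (inj₂ (inj₂ refl)) _ = refl , refl , inj₁ refl , inj₂ (inj₁ refl)
sign-halves (inj₂ (inj₂ refl)) (inj₂ (inj₁ refl)) _ = refl , refl , inj₁ refl , inj₂ (inj₂ refl)
sign-halves (inj₂ (inj₂ refl)) (inj₂ (inj₂ refl)) _ = refl , refl , inj₂ (inj₂ refl) , inj₁ refl
sign-halves (inj₁ refl) (inj₂ (inj₁ refl)) a≡0⇔c≡0 with () ← Equivalence.to a≡0⇔c≡0 refl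
sign-halves (inj₁ refl) (inj₂ (inj₂ refl)) a≡0⇔c≡0 with () ← Equivalence.to a≡0⇔c≡0 refl
sign-halves (inj₂ (inj₁ refl)) (inj₁ refl) a≡0⇔c≡0 with () ← Equivalence.from a≡0⇔c≡0 refl
sign-halves (inj₂ (inj₂ refl)) (inj₁ refl) a≡0⇔c≡0 with () ← Equivalence.from a≡0⇔c≡0 refl

halves-d≡0⇒≡ : ∀ {a c s d} → a ≡ s + d → c ≡ s - d → d ≡ 0ℤ → a ≡ c
halves-d≡0⇒≡ refl refl refl = refl

halves-s≡0⇒≡- : ∀ {a c s d} → a ≡ s + d → c ≡ s - d → s ≡ 0ℤ → a ≡ - c
halves-s≡0⇒≡- {d = d} refl refl refl = 0+d≡-[0-d] d
  where
  0+d≡-[0-d] : ∀ d → 0ℤ + d ≡ - (0ℤ - d)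
  0+d≡-[0-d] = solve-∀

-- The group ring ℤ[ℤ/p] and the ideal generated by u = z − 1

module GroupRing (p : ℕ) .{{_ : NonZero p}} where
  open Modular p

  ℤ[ℤ/p] : Set
  ℤ[ℤ/p] = Fin p → ℤ

  infix  4 _≈_
  infixl 6 _⊞_ _⊟_
  infixl 7 _⊛_
  infixr 8 _·_

  _≈_ : ℤ[ℤ/p] → ℤ[ℤ/p] → Set
  X ≈ Y = ∀ b → X b ≡ Y b

  _⊞_ _⊟_ _⊛_ : ℤ[ℤ/p] → ℤ[ℤ/p] → ℤ[ℤ/p]
  (X ⊞ Y) b = X b + Y b
  (X ⊟ Y) b = X b - Y b
  _⊛_ = _⋆_ p

  _·_ : ℤ → ℤ[ℤ/p] → ℤ[ℤ/p]
  (c · X) b = c * X b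

  0ᴳ 1ᴳ : ℤ[ℤ/p]
  0ᴳ = const 0ℤ
  1ᴳ = δ 0ₚ

  sum-reflect : ∀ b (g : ℤ[ℤ/p]) → sum (λ a → g (b -ₚ a)) ≡ sum g
  sum-reflect b g = sym (sum-permute g (permutation (b -ₚ_) (b -ₚ_) (x-ₚ[x-ₚy]≡y b) (x-ₚ[x-ₚy]≡y b)))

  sum-∘+ₚ : ∀ c (g : ℤ[ℤ/p]) → sum (λ a → g (a +ₚ c)) ≡ sum g
  sum-∘+ₚ c g = sym (sum-permute g (permutation (_+ₚ c) (_-ₚ c) (λ y → x-ₚy+ₚy≡x y c) (λ y → x+ₚy-ₚy≡x y c)))

  sum-∘-ₚ : ∀ c (g : ℤ[ℤ/p]) → sum (λ a → g (a -ₚ c)) ≡ sum g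
  sum-∘-ₚ c g = sym (sum-permute g (permutation (_-ₚ c) (_+ₚ c) (λ y → x+ₚy-ₚy≡x y c) (λ y → x-ₚy+ₚy≡x y c)))

  ⊛-comm : ∀ X Y → X ⊛ Y ≈ Y ⊛ X
  ⊛-comm X Y b = begin
    sum (λ a → X (b -ₚ a) * Y a)
      ≡⟨ sum-reflect b (λ a → X (b -ₚ a) * Y a) ⟨
    sum (λ a → X (b -ₚ (b -ₚ a)) * Y (b -ₚ a))
      ≡⟨ sum-cong-≗ {p} (λ a → cong (λ k → X k * Y (b -ₚ a)) (x-ₚ[x-ₚy]≡y b a)) ⟩
    sum (λ a → X a * Y (b -ₚ a))
      ≡⟨ sum-cong-≗ {p} (λ a → ℤ.*-comm (X a) _) ⟩
    sum (λ a → Y (b -ₚ a) * X a) ∎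
    where open ≡-Reasoning

  ⊛-assoc : ∀ X Y Z → (X ⊛ Y) ⊛ Z ≈ X ⊛ (Y ⊛ Z)
  ⊛-assoc X Y Z b = begin
    sum (λ a → sum (λ c → X (b -ₚ a -ₚ c) * Y c) * Z a)
      ≡⟨ sum-cong-≗ {p} (λ a → *-distribʳ-sum (Z a) (λ c → X (b -ₚ a -ₚ c) * Y c)) ⟩
    sum (λ a → sum (λ c → X (b -ₚ a -ₚ c) * Y c * Z a))
      ≡⟨ sum-cong-≗ {p} (λ a → sum-cong-≗ {p} (λ c →
           cong₂ (λ k l → X k * Y l * Z a) (sym (x-ₚ[y+ₚw]≡x-ₚw-ₚy b c a)) (sym (x+ₚy-ₚy≡x c a)))) ⟩
    sum (λ a → sum (λ c → X (b -ₚ (c +ₚ a)) * Y (c +ₚ a -ₚ a) * Z a))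
      ≡⟨ sum-cong-≗ {p} (λ a → sum-∘+ₚ a (λ c → X (b -ₚ c) * Y (c -ₚ a) * Z a)) ⟩
    sum (λ a → sum (λ c → X (b -ₚ c) * Y (c -ₚ a) * Z a))
      ≡⟨ ∑-comm {p} {p} (λ a c → X (b -ₚ c) * Y (c -ₚ a) * Z a) ⟩
    sum (λ c → sum (λ a → X (b -ₚ c) * Y (c -ₚ a) * Z a))
      ≡⟨ sum-cong-≗ {p} (λ c → sum-cong-≗ {p} (λ a → ℤ.*-assoc (X (b -ₚ c)) _ _)) ⟩
    sum (λ c → sum (λ a → X (b -ₚ c) * (Y (c -ₚ a) * Z a)))
      ≡⟨ sum-cong-≗ {p} (λ c → *-distribˡ-sum (X (b -ₚ c)) (λ a → Y (c -ₚ a) * Z a)) ⟨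
    sum (λ c → X (b -ₚ c) * sum (λ a → Y (c -ₚ a) * Z a))
      ∎
    where open ≡-Reasoning

  ⊛-cong : ∀ {X X′ Y Y′} → X ≈ X′ → Y ≈ Y′ → X ⊛ Y ≈ X′ ⊛ Y′
  ⊛-cong X≈X′ Y≈Y′ b = sum-cong-≗ {p} (λ a → cong₂ _*_ (X≈X′ (b -ₚ a)) (Y≈Y′ a))

  ⊛-distribˡ-⊞ : ∀ X Y Z → X ⊛ (Y ⊞ Z) ≈ X ⊛ Y ⊞ X ⊛ Z
  ⊛-distribˡ-⊞ X Y Z b = trans (sum-cong-≗ {p} (λ a → ℤ.*-distribˡ-+ (X (b -ₚ a)) (Y a) (Z a)))
                               (∑-distrib-+ {p} (λ a → X (b -ₚ a) * Y a) (λ a → X (b -ₚ a) * Z a))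

  ⊛-zeroʳ : ∀ X → X ⊛ 0ᴳ ≈ 0ᴳ
  ⊛-zeroʳ X b = trans (sum-cong-≗ {p} (λ a → ℤ.*-zeroʳ (X (b -ₚ a)))) (sum-replicate-zero p)

  ⊛-δ : ∀ X c b → (X ⊛ δ c) b ≡ X (b -ₚ c)
  ⊛-δ X c b = trans (sum-cong-≗ {p} (λ a → ℤ.*-comm (X (b -ₚ a)) (δ c a))) (sum-δ* c (λ a → X (b -ₚ a)))

  ⊛-identityʳ : ∀ X → X ⊛ 1ᴳ ≈ X
  ⊛-identityʳ X b = trans (⊛-δ X 0ₚ b) (cong X (x-ₚ0≡x b))

  ⊛-·ʳ : ∀ c X Y → X ⊛ c · Y ≈ c · (X ⊛ Y)
  ⊛-·ʳ c X Y b = begin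
    sum (λ a → X (b -ₚ a) * (c * Y a))   ≡⟨ sum-cong-≗ {p} (λ a → x*[c*y]≡c*[x*y] (X (b -ₚ a)) c (Y a)) ⟩
    sum (λ a → c * (X (b -ₚ a) * Y a))   ≡⟨ *-distribˡ-sum c (λ a → X (b -ₚ a) * Y a) ⟨
    c * sum (λ a → X (b -ₚ a) * Y a)     ∎
    where
    open ≡-Reasoning
    x*[c*y]≡c*[x*y] : ∀ x c y → x * (c * y) ≡ c * (x * y)
    x*[c*y]≡c*[x*y] = solve-∀

  ⊞-⊛-isCommutativeSemiringˡ : IsCommutativeSemiringˡ _≈_ _⊞_ _⊛_ 0ᴳ 1ᴳ
  ⊞-⊛-isCommutativeSemiringˡ = record
    { +-isCommutativeMonoid = record
      { isMonoid = record
        { isSemigroup = record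
          { isMagma = record { isEquivalence = ≈-isEquivalence ; ∙-cong = λ X≈X′ Y≈Y′ b → cong₂ _+_ (X≈X′ b) (Y≈Y′ b) }
          ; assoc = λ X Y Z b → ℤ.+-assoc (X b) (Y b) (Z b) }
        ; identity = (λ X b → ℤ.+-identityˡ (X b)) , (λ X b → ℤ.+-identityʳ (X b)) }
      ; comm = λ X Y b → ℤ.+-comm (X b) (Y b) }
    ; *-isCommutativeMonoid = record
      { isMonoid = record
        { isSemigroup = record
          { isMagma = record { isEquivalence = ≈-isEquivalence ; ∙-cong = ⊛-cong }
          ; assoc = ⊛-assoc }
        ; identity = (λ X b → trans (⊛-comm 1ᴳ X b) (⊛-identityʳ X b)) , ⊛-identityʳ }
      ; comm = ⊛-comm }
    ; distribʳ = λ X Y Z b → trans (⊛-comm (Y ⊞ Z) X b)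
                               (trans (⊛-distribˡ-⊞ X Y Z b) (cong₂ _+_ (⊛-comm X Y b) (⊛-comm X Z b)))
    ; zeroˡ = λ X b → trans (⊛-comm 0ᴳ X b) (⊛-zeroʳ X b) }
    where
    ≈-isEquivalence : IsEquivalence _≈_
    ≈-isEquivalence = record { refl = λ _ → refl ; sym = λ X≈Y b → sym (X≈Y b) ; trans = λ X≈Y Y≈Z b → trans (X≈Y b) (Y≈Z b) }

  ⊞-⊛-commutativeSemiring : CommutativeSemiring _ _
  ⊞-⊛-commutativeSemiring = record
    { isCommutativeSemiring = IsCommutativeSemiringˡ.isCommutativeSemiring ⊞-⊛-isCommutativeSemiringˡ }

  ∣-⊛ : ∀ {d} X Y → (∀ b → d ∣ Y b) → ∀ b → d ∣ (X ⊛ Y) b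
  ∣-⊛ X Y d∣Y b = ∣-sum (λ a → X (b -ₚ a) * Y a) (λ a → ∣n⇒∣m*n (X (b -ₚ a)) (d∣Y a))

  ⊛-difference-of-squares : ∀ S D b → ((S ⊞ D) ⊛ (S ⊞ D)) b ≡ ((S ⊟ D) ⊛ (S ⊟ D)) b + + 4 * (S ⊛ D) b
  ⊛-difference-of-squares S D b = begin
    sum (λ a → (S ⊞ D) (b -ₚ a) * (S ⊞ D) a)
      ≡⟨ sum-cong-≗ {p} (λ a → expand (S (b -ₚ a)) (D (b -ₚ a)) (S a) (D a)) ⟩
    sum (λ a → M a + (+ 2 * (S (b -ₚ a) * D a) + + 2 * (D (b -ₚ a) * S a)))
      ≡⟨ ∑-distrib-+ {p} M (λ a → + 2 * (S (b -ₚ a) * D a) + + 2 * (D (b -ₚ a) * S a)) ⟩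
    sum M + sum (λ a → + 2 * (S (b -ₚ a) * D a) + + 2 * (D (b -ₚ a) * S a))
      ≡⟨ cong (λ t → sum M + t) (∑-distrib-+ {p} (λ a → + 2 * (S (b -ₚ a) * D a)) (λ a → + 2 * (D (b -ₚ a) * S a))) ⟩
    sum M + (sum (λ a → + 2 * (S (b -ₚ a) * D a)) + sum (λ a → + 2 * (D (b -ₚ a) * S a)))
      ≡⟨ cong (λ t → sum M + t)
              (cong₂ _+_ (*-distribˡ-sum (+ 2) (λ a → S (b -ₚ a) * D a)) (*-distribˡ-sum (+ 2) (λ a → D (b -ₚ a) * S a))) ⟨
    sum M + (+ 2 * (S ⊛ D) b + + 2 * (D ⊛ S) b)
      ≡⟨ cong (λ t → sum M + (+ 2 * (S ⊛ D) b + + 2 * t)) (⊛-comm D S b) ⟩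
    sum M + (+ 2 * (S ⊛ D) b + + 2 * (S ⊛ D) b)
      ≡⟨ cong (λ t → sum M + t) (2x+2x≡4x ((S ⊛ D) b)) ⟩
    sum M + + 4 * (S ⊛ D) b
      ∎
    where
    open ≡-Reasoning
    M : Fin p → ℤ
    M a = (S ⊟ D) (b -ₚ a) * (S ⊟ D) a
    expand : ∀ s d s′ d′ → (s + d) * (s′ + d′) ≡ (s - d) * (s′ - d′) + (+ 2 * (s * d′) + + 2 * (d * s′))
    expand = solve-∀
    2x+2x≡4x : ∀ x → + 2 * x + + 2 * x ≡ + 4 * x
    2x+2x≡4x = solve-∀

  [S⊞D]²≈[S⊟D]²⇒S⊛D≈0 : ∀ {S D} → (S ⊞ D) ⊛ (S ⊞ D) ≈ (S ⊟ D) ⊛ (S ⊟ D) → S ⊛ D ≈ 0ᴳ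
  [S⊞D]²≈[S⊟D]²⇒S⊛D≈0 {S} {D} squares≈ b =
    ℤ.*-cancelˡ-≡ (+ 4) _ 0ℤ (identityʳ-unique (((S ⊟ D) ⊛ (S ⊟ D)) b) _
      (trans (sym (⊛-difference-of-squares S D b)) (squares≈ b)))

  open CommutativeSemiring ⊞-⊛-commutativeSemiring public
    using (setoid; semiring; *-commutativeSemigroup; +-assoc; +-cong; +-congˡ; +-congʳ; *-congˡ; *-assoc; *-identityˡ; distribˡ)
  open CommutativeSemigroupProperties *-commutativeSemigroup public using (x∙yz≈y∙xz)
  open SemiringExp semiring public using (_^_; ^-congˡ; ^-homo-*)

  N : ℤ[ℤ/p]
  N = const 1ℤ

  ε : ℤ[ℤ/p] → ℤ
  ε X = sum X

  ε-⊞ : ∀ X Y → ε (X ⊞ Y) ≡ ε X + ε Y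
  ε-⊞ X Y = ∑-distrib-+ {p} X Y

  ε-· : ∀ c X → ε (c · X) ≡ c * ε X
  ε-· c X = sym (*-distribˡ-sum c X)

  ε-δ : ∀ c → ε (δ c) ≡ 1ℤ
  ε-δ c = trans (sum-cong-≗ {p} (λ a → sym (ℤ.*-identityʳ (δ c a)))) (sum-δ* c (const 1ℤ))

  ε-N : ε N ≡ + p
  ε-N = trans (sum-const p 1ℤ) (ℤ.*-identityʳ (+ p))

  ε-⊛ : ∀ X Y → ε (X ⊛ Y) ≡ ε X * ε Y
  ε-⊛ X Y = begin
    sum (λ b → sum (λ a → X (b -ₚ a) * Y a))   ≡⟨ ∑-comm {p} {p} (λ b a → X (b -ₚ a) * Y a) ⟩
    sum (λ a → sum (λ b → X (b -ₚ a) * Y a))   ≡⟨ sum-cong-≗ {p} (λ a → *-distribʳ-sum (Y a) (λ b → X (b -ₚ a))) ⟨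
    sum (λ a → sum (λ b → X (b -ₚ a)) * Y a)   ≡⟨ sum-cong-≗ {p} (λ a → cong (_* Y a) (sum-∘-ₚ a X)) ⟩
    sum (λ a → ε X * Y a)                      ≡⟨ *-distribˡ-sum (ε X) Y ⟨
    ε X * ε Y                                  ∎
    where open ≡-Reasoning

  -- X ∼ Y says that X − Y is a constant function, i.e. X ≡ Y modulo the ideal ℤN;
  -- the quotient ℤ[ℤ/p]/ℤN is the ring of integers ℤ[ζₚ].
  infix 4 _∼_
  record _∼_ (X Y : ℤ[ℤ/p]) : Set where
    constructor mk∼
    field
      offset   : ℤ
      X≡Y+offset : ∀ b → X b ≡ Y b + offset

  ≈⇒∼ : ∀ {X Y} → X ≈ Y → X ∼ Y
  ≈⇒∼ X≈Y = mk∼ 0ℤ λ b → trans (X≈Y b) (sym (ℤ.+-identityʳ _))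

  ∼-sym : ∀ {X Y} → X ∼ Y → Y ∼ X
  ∼-sym (mk∼ c X≡Y+c) = mk∼ (- c) λ b → trans (y≡[y+c]-c _ c) (cong (_- c) (sym (X≡Y+c b)))
    where
    y≡[y+c]-c : ∀ y c → y ≡ y + c - c
    y≡[y+c]-c = solve-∀

  ∼-trans : ∀ {X Y Z} → X ∼ Y → Y ∼ Z → X ∼ Z
  ∼-trans {Z = Z} (mk∼ c X≡Y+c) (mk∼ c′ Y≡Z+c′) =
    mk∼ (c′ + c) λ b → trans (X≡Y+c b) (trans (cong (_+ c) (Y≡Z+c′ b)) (ℤ.+-assoc (Z b) c′ c))

  ⊛-congʳ-∼ : ∀ X {Y Y′} → Y ∼ Y′ → X ⊛ Y ∼ X ⊛ Y′
  ⊛-congʳ-∼ X {Y} {Y′} (mk∼ c Y≡Y′+c) = mk∼ (ε X * c) λ b → begin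
    sum (λ a → X (b -ₚ a) * Y a)
      ≡⟨ sum-cong-≗ {p} (λ a → trans (cong (X (b -ₚ a) *_) (Y≡Y′+c a)) (ℤ.*-distribˡ-+ (X (b -ₚ a)) (Y′ a) c)) ⟩
    sum (λ a → X (b -ₚ a) * Y′ a + X (b -ₚ a) * c)
      ≡⟨ ∑-distrib-+ {p} (λ a → X (b -ₚ a) * Y′ a) (λ a → X (b -ₚ a) * c) ⟩
    (X ⊛ Y′) b + sum (λ a → X (b -ₚ a) * c)
      ≡⟨ cong (λ t → (X ⊛ Y′) b + t) (*-distribʳ-sum c (λ a → X (b -ₚ a))) ⟨
    (X ⊛ Y′) b + sum (λ a → X (b -ₚ a)) * c
      ≡⟨ cong (λ t → (X ⊛ Y′) b + t * c) (sum-reflect b X) ⟩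
    (X ⊛ Y′) b + ε X * c ∎
    where open ≡-Reasoning

  ⊛-cong-∼ : ∀ {X X′ Y Y′} → X ∼ X′ → Y ∼ Y′ → X ⊛ Y ∼ X′ ⊛ Y′
  ⊛-cong-∼ {X} {X′} {Y} {Y′} X∼X′ Y∼Y′ =
    ∼-trans (⊛-congʳ-∼ X Y∼Y′)
      (∼-trans (≈⇒∼ (⊛-comm X Y′)) (∼-trans (⊛-congʳ-∼ Y′ X∼X′) (≈⇒∼ (⊛-comm Y′ X′))))

  ε-offset : ∀ {X} (X∼0 : X ∼ 0ᴳ) → ε X ≡ + p * _∼_.offset X∼0
  ε-offset (mk∼ c X≡0+c) = trans (sum-cong-≗ {p} X≡0+c) (begin
    sum {p} (λ _ → 0ℤ + c)   ≡⟨ ∑-distrib-+ {p} 0ᴳ (const c) ⟩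
    ε 0ᴳ + sum {p} (const c) ≡⟨ cong₂ _+_ (sum-replicate-zero p) (sum-const p c) ⟩
    0ℤ + + p * c             ≡⟨ ℤ.+-identityˡ _ ⟩
    + p * c                  ∎)
    where open ≡-Reasoning

  ε-∼0⇒p∣ : ∀ {X} → X ∼ 0ᴳ → + p ∣ ε X
  ε-∼0⇒p∣ X∼0 = divides (_∼_.offset X∼0) (trans (ε-offset X∼0) (ℤ.*-comm (+ p) _))

  z u : ℤ[ℤ/p]
  z = δ 1ₚ
  u = z ⊞ -1ℤ · 1ᴳ

  u⊞1≈z : u ⊞ 1ᴳ ≈ z
  u⊞1≈z b = x+-1*y+y≡x (z b) (1ᴳ b)
    where
    x+-1*y+y≡x : ∀ x y → x + -1ℤ * y + y ≡ x
    x+-1*y+y≡x = solve-∀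

  ε-u : ε u ≡ 0ℤ
  ε-u = trans (ε-⊞ z (-1ℤ · 1ᴳ)) (cong₂ _+_ (ε-δ 1ₚ) (trans (ε-· -1ℤ 1ᴳ) (cong (-1ℤ *_) (ε-δ 0ₚ))))

  ⊛-u : ∀ X b → (X ⊛ u) b ≡ X (b -ₚ 1ₚ) - X b
  ⊛-u X b = begin
    (X ⊛ u) b                        ≡⟨ ⊛-distribˡ-⊞ X z (-1ℤ · 1ᴳ) b ⟩
    (X ⊛ z) b + (X ⊛ -1ℤ · 1ᴳ) b     ≡⟨ cong₂ _+_ (⊛-δ X 1ₚ b) (⊛-·ʳ -1ℤ X 1ᴳ b) ⟩
    X (b -ₚ 1ₚ) + -1ℤ * (X ⊛ 1ᴳ) b   ≡⟨ cong (λ t → X (b -ₚ 1ₚ) + t) (trans (ℤ.-1*i≡-i _) (cong -_ (⊛-identityʳ X b))) ⟩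
    X (b -ₚ 1ₚ) - X b                ∎
    where open ≡-Reasoning

  z⊛δ : ∀ c → z ⊛ δ c ≈ δ (c +ₚ 1ₚ)
  z⊛δ c b = trans (⊛-δ z c b) (δ-cong (mk⇔ to from))
    where
    to : b -ₚ c ≡ 1ₚ → b ≡ c +ₚ 1ₚ
    to b-c≡1 = trans (sym (x-ₚy+ₚy≡x b c)) (trans (cong (_+ₚ c) b-c≡1) (+ₚ-comm 1ₚ c))
    from : b ≡ c +ₚ 1ₚ → b -ₚ c ≡ 1ₚ
    from refl = trans (cong (_-ₚ c) (+ₚ-comm c 1ₚ)) (x+ₚy-ₚy≡x 1ₚ c)

  z^ : ∀ n → z ^ n ≈ δ (n mod p)
  z^ zero    b = refl
  z^ (suc n) b = trans (⊛-cong {z} (λ _ → refl) (z^ n) b) (trans (z⊛δ (n mod p) b) (cong (λ c → δ c b) (suc-mod n)))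

  1ᴳ^ : ∀ n → 1ᴳ ^ n ≈ 1ᴳ
  1ᴳ^ zero    b = refl
  1ᴳ^ (suc n) b = trans (*-identityˡ (1ᴳ ^ n) b) (1ᴳ^ n b)

  u⊛-cancel : ∀ Z → u ⊛ Z ∼ 0ᴳ → Z ∼ 0ᴳ
  u⊛-cancel Z uZ∼0@(mk∼ c uZ≡0+c) = mk∼ (Z 0ₚ) λ b → trans (Z-constant b) (sym (ℤ.+-identityˡ _))
    where
    pc≡0 : + p * c ≡ 0ℤ
    pc≡0 = trans (sym (ε-offset uZ∼0)) (trans (ε-⊛ u Z) (cong (_* ε Z) ε-u))
    c≡0 : c ≡ 0ℤ
    c≡0 with ℤ.i*j≡0⇒i≡0∨j≡0 (+ p) pc≡0
    ... | inj₁ p≡0 = ⊥-elim (ℕ.≢-nonZero⁻¹ p (ℤ.+-injective p≡0))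
    ... | inj₂ c≡0 = c≡0
    Z-periodic : ∀ x → Z (x -ₚ 1ₚ) ≡ Z x
    Z-periodic x = ℤ.i-j≡0⇒i≡j _ _ (trans (sym (⊛-u Z x)) (trans (⊛-comm Z u x) (trans (uZ≡0+c x) (trans (ℤ.+-identityˡ c) c≡0))))
    Z-constant : ∀ x → Z x ≡ Z 0ₚ
    Z-constant = +ₚ1-induction (λ x → Z x ≡ Z 0ₚ) refl
      (λ x Zx≡Z0 → trans (sym (Z-periodic (x +ₚ 1ₚ))) (trans (cong Z (x+ₚy-ₚy≡x x 1ₚ)) Zx≡Z0))

  u^-cancel : ∀ a Z → u ^ a ⊛ Z ∼ 0ᴳ → Z ∼ 0ᴳ
  u^-cancel zero    Z Z∼0       = ∼-trans (≈⇒∼ (λ b → sym (*-identityˡ Z b))) Z∼0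
  u^-cancel (suc a) Z uᵃ⁺¹Z∼0 =
    u^-cancel a Z (u⊛-cancel (u ^ a ⊛ Z) (∼-trans (≈⇒∼ (λ b → sym (*-assoc u (u ^ a) Z b))) uᵃ⁺¹Z∼0))

  -- G n = 1 + z + ⋯ + zⁿ⁻¹, so that u ⊛ G n = zⁿ − 1.
  G : ℕ → ℤ[ℤ/p]
  G zero    = 0ᴳ
  G (suc n) = z ⊛ G n ⊞ 1ᴳ

  u⊛G⊞1≈δ : ∀ n → u ⊛ G n ⊞ 1ᴳ ≈ δ (n mod p)
  u⊛G⊞1≈δ zero    b = trans (cong (_+ 1ᴳ b) (⊛-zeroʳ u b)) (ℤ.+-identityˡ _)
  u⊛G⊞1≈δ (suc n)   = begin
    u ⊛ (z ⊛ G n ⊞ 1ᴳ) ⊞ 1ᴳ        ≈⟨ +-congʳ {1ᴳ} (distribˡ u (z ⊛ G n) 1ᴳ) ⟩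
    u ⊛ (z ⊛ G n) ⊞ u ⊛ 1ᴳ ⊞ 1ᴳ    ≈⟨ +-assoc (u ⊛ (z ⊛ G n)) (u ⊛ 1ᴳ) 1ᴳ ⟩
    u ⊛ (z ⊛ G n) ⊞ (u ⊛ 1ᴳ ⊞ 1ᴳ)  ≈⟨ +-cong (x∙yz≈y∙xz u z (G n)) (+-congʳ {1ᴳ} (⊛-identityʳ u)) ⟩
    z ⊛ (u ⊛ G n) ⊞ (u ⊞ 1ᴳ)       ≈⟨ +-congˡ {z ⊛ (u ⊛ G n)} u⊞1≈z ⟩
    z ⊛ (u ⊛ G n) ⊞ z              ≈⟨ +-congˡ {z ⊛ (u ⊛ G n)} (⊛-identityʳ z) ⟨
    z ⊛ (u ⊛ G n) ⊞ z ⊛ 1ᴳ         ≈⟨ distribˡ z (u ⊛ G n) 1ᴳ ⟨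
    z ⊛ (u ⊛ G n ⊞ 1ᴳ)             ≈⟨ *-congˡ {z} (u⊛G⊞1≈δ n) ⟩
    z ⊛ δ (n mod p)                ≈⟨ z⊛δ (n mod p) ⟩
    δ (n mod p +ₚ 1ₚ)              ≡⟨ cong δ (suc-mod n) ⟩
    δ (suc n mod p)                ∎
    where open SetoidReasoning setoid

  ⊛-sum : ∀ Y (k : Fin p → ℤ) (F : Fin p → ℤ[ℤ/p]) b →
          (Y ⊛ (λ c → sum (λ a → k a * F a c))) b ≡ sum (λ a → k a * (Y ⊛ F a) b)
  ⊛-sum Y k F b = begin
    sum (λ c → Y (b -ₚ c) * sum (λ a → k a * F a c))
      ≡⟨ sum-cong-≗ {p} (λ c → *-distribˡ-sum (Y (b -ₚ c)) (λ a → k a * F a c)) ⟩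
    sum (λ c → sum (λ a → Y (b -ₚ c) * (k a * F a c)))
      ≡⟨ ∑-comm {p} {p} (λ c a → Y (b -ₚ c) * (k a * F a c)) ⟩
    sum (λ a → sum (λ c → Y (b -ₚ c) * (k a * F a c)))
      ≡⟨ sum-cong-≗ {p} (λ a → sum-cong-≗ {p} (λ c → x*[y*w]≡y*[x*w] (Y (b -ₚ c)) (k a) (F a c))) ⟩
    sum (λ a → sum (λ c → k a * (Y (b -ₚ c) * F a c)))
      ≡⟨ sum-cong-≗ {p} (λ a → *-distribˡ-sum (k a) (λ c → Y (b -ₚ c) * F a c)) ⟨
    sum (λ a → k a * (Y ⊛ F a) b) ∎
    where
    open ≡-Reasoning
    x*[y*w]≡y*[x*w] : ∀ x y w → x * (y * w) ≡ y * (x * w)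
    x*[y*w]≡y*[x*w] = solve-∀

  -- Writing X = Σₐ X(a) zᵃ, this is X − ε(X) = Σₐ X(a) (zᵃ − 1) = u ⊛ Σₐ X(a) G a.
  u⊛-quotient : ℤ[ℤ/p] → ℤ[ℤ/p]
  u⊛-quotient X c = sum (λ a → X a * G (toℕ a) c)

  ≈u⊛-quotient⊞ε : ∀ X → X ≈ u ⊛ u⊛-quotient X ⊞ ε X · 1ᴳ
  ≈u⊛-quotient⊞ε X b = sym (begin
    (u ⊛ u⊛-quotient X) b + ε X * 1ᴳ b
      ≡⟨ cong₂ _+_ (⊛-sum u X (G ∘ toℕ) b) (*-distribʳ-sum (1ᴳ b) X) ⟩
    sum (λ a → X a * (u ⊛ G (toℕ a)) b) + sum (λ a → X a * 1ᴳ b)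
      ≡⟨ ∑-distrib-+ {p} (λ a → X a * (u ⊛ G (toℕ a)) b) (λ a → X a * 1ᴳ b) ⟨
    sum (λ a → X a * (u ⊛ G (toℕ a)) b + X a * 1ᴳ b)
      ≡⟨ sum-cong-≗ {p} (λ a → sym (ℤ.*-distribˡ-+ (X a) _ _)) ⟩
    sum (λ a → X a * (u ⊛ G (toℕ a) ⊞ 1ᴳ) b)
      ≡⟨ sum-cong-≗ {p} (λ a → cong (X a *_) (trans (u⊛G⊞1≈δ (toℕ a) b) (cong (λ c → δ c b) (toℕ-mod-inverse a)))) ⟩
    sum (λ a → X a * δ a b)
      ≡⟨ sum-cong-≗ {p} (λ a → trans (ℤ.*-comm (X a) _) (cong (_* X a) (δ-sym a b))) ⟩
    sum (λ a → δ b a * X a)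
      ≡⟨ sum-δ* b X ⟩
    X b ∎)
    where open ≡-Reasoning

  p∣ε⇒u∣ : ∀ X → + p ∣ ε X → ∃ λ Y → X ∼ u ⊛ Y
  p∣ε⇒u∣ X (divides q εX≡q*p) = Y , mk∼ q X≡u⊛Y+q
    where
    A B Y : ℤ[ℤ/p]
    A = u ⊛ u⊛-quotient X
    B = u ⊛ u⊛-quotient N
    Y = u⊛-quotient X ⊞ (- q) · u⊛-quotient N
    regroup : ∀ a b q n e → a + q * n * e ≡ a + - q * b + q * (b + n * e)
    regroup = solve-∀
    X≡u⊛Y+q : ∀ b → X b ≡ (u ⊛ Y) b + q
    X≡u⊛Y+q b = begin
      X b                                        ≡⟨ ≈u⊛-quotient⊞ε X b ⟩
      A b + ε X * 1ᴳ b                           ≡⟨ cong (λ t → A b + t * 1ᴳ b) εX≡q*p ⟩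
      A b + q * + p * 1ᴳ b                       ≡⟨ regroup (A b) (B b) q (+ p) (1ᴳ b) ⟩
      A b + - q * B b + q * (B b + + p * 1ᴳ b)   ≡⟨ cong (λ t → A b + - q * B b + q * (B b + t * 1ᴳ b)) ε-N ⟨
      A b + - q * B b + q * (B b + ε N * 1ᴳ b)   ≡⟨ cong (λ t → A b + - q * B b + q * t) (≈u⊛-quotient⊞ε N b) ⟨
      A b + - q * B b + q * 1ℤ                   ≡⟨ cong₂ _+_ u⊛Y≡A-qB (sym (ℤ.*-identityʳ q)) ⟨
      (u ⊛ Y) b + q                              ∎
      where
      open ≡-Reasoning
      u⊛Y≡A-qB : (u ⊛ Y) b ≡ A b + - q * B b
      u⊛Y≡A-qB = trans (⊛-distribˡ-⊞ u _ _ b) (cong (λ t → A b + t) (⊛-·ʳ (- q) u (u⊛-quotient N) b))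

  u^_divides_ : ℕ → ℤ[ℤ/p] → Set
  u^ a divides X = ∃ λ Y → X ∼ u ^ a ⊛ Y

  u^-divides-suc : ∀ {a X Y} → X ∼ u ^ a ⊛ Y → + p ∣ ε Y → u^ suc a divides X
  u^-divides-suc {a} {Y = Y} X∼uᵃY p∣εY with p∣ε⇒u∣ Y p∣εY
  ... | Y′ , Y∼uY′ = Y′ , ∼-trans X∼uᵃY (∼-trans (⊛-congʳ-∼ (u ^ a) Y∼uY′) (≈⇒∼ uᵃ[uY′]≈uᵃ⁺¹Y′))
    where
    uᵃ[uY′]≈uᵃ⁺¹Y′ : u ^ a ⊛ (u ⊛ Y′) ≈ u ^ suc a ⊛ Y′
    uᵃ[uY′]≈uᵃ⁺¹Y′ b = trans (x∙yz≈y∙xz (u ^ a) u Y′ b) (sym (*-assoc u (u ^ a) Y′ b))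

  u^0-divides : ∀ X → u^ 0 divides X
  u^0-divides X = X , ≈⇒∼ (λ b → sym (*-identityˡ X b))

-- u-adic valuations for prime p

module _ {p : ℕ} (p-prime : Prime p) where
  private instance
    p≢0 : NonZero p
    p≢0 = prime⇒nonZero p-prime

  open Modular p
  open GroupRing p
  open import Algebra.Properties.CommutativeSemiring.Binomial ⊞-⊛-commutativeSemiring using (theorem; binomialTerm)
  open import Algebra.Properties.Semiring.Sum semiring using () renaming (sum to ∑ᴳ)
  open import Algebra.Properties.Semiring.Mult semiring using () renaming (_×_ to _×ᴳ_)

  ∑ᴳ-apply : ∀ {n} (Xs : Fin n → ℤ[ℤ/p]) b → ∑ᴳ Xs b ≡ sum (λ k → Xs k b)
  ∑ᴳ-apply {zero}  Xs b = refl
  ∑ᴳ-apply {suc n} Xs b = cong (λ t → Xs zero b + t) (∑ᴳ-apply (Xs ∘ suc) b)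

  ×ᴳ-apply : ∀ n X b → (n ×ᴳ X) b ≡ + n * X b
  ×ᴳ-apply n X b = trans (×ᴳ-apply-sum n) (sum-const n (X b))
    where
    ×ᴳ-apply-sum : ∀ n → (n ×ᴳ X) b ≡ sum {n} (const (X b))
    ×ᴳ-apply-sum zero    = refl
    ×ᴳ-apply-sum (suc n) = cong (λ t → X b + t) (×ᴳ-apply-sum n)

  frobenius : ∀ X Y b → + p ∣ ((X ⊞ Y) ^ p) b - ((X ^ p) b + (Y ^ p) b)
  frobenius X Y b = subst (λ t → + p ∣ t - ((X ^ p) b + (Y ^ p) b)) expansion≡sum
    (subst (λ t → + p ∣ sum F - t) (cong₂ _+_ F[p]≡Xᵖ F[0]≡Yᵖ)
      (∣-sum-but-two F fromℕp≢0 p∣F[k]))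
    where
    term : ℕ → ℤ
    term j = + (p C j) * ((X ^ j) ⊛ (Y ^ (p ∸ j))) b
    F : Fin (suc p) → ℤ
    F k = binomialTerm X Y p k b
    F≡term : ∀ k → F k ≡ term (toℕ k)
    F≡term k = ×ᴳ-apply (p C toℕ k) _ b
    expansion≡sum : sum F ≡ ((X ⊞ Y) ^ p) b
    expansion≡sum = trans (sym (∑ᴳ-apply (binomialTerm X Y p) b)) (sym (theorem p X Y b))
    F[p]≡Xᵖ : F (fromℕ p) ≡ (X ^ p) b
    F[p]≡Xᵖ rewrite F≡term (fromℕ p) | toℕ-fromℕ p | nCn≡1 p | ℕ.n∸n≡0 p =
      trans (ℤ.*-identityˡ _) (⊛-identityʳ (X ^ p) b)
    F[0]≡Yᵖ : F zero ≡ (Y ^ p) b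
    F[0]≡Yᵖ = trans (F≡term zero) (trans (ℤ.*-identityˡ _) (*-identityˡ (Y ^ p) b))
    fromℕp≢0 : fromℕ p ≢ zero
    fromℕp≢0 p≡0 = ℕ.≢-nonZero⁻¹ p (trans (sym (toℕ-fromℕ p)) (cong toℕ p≡0))
    0<k : ∀ {k} → k ≢ zero → 0 ℕ.< toℕ k
    0<k k≢0 = ℕ.n≢0⇒n>0 (λ k≡0 → k≢0 (toℕ-injective k≡0))
    k<p : ∀ {k} → k ≢ fromℕ p → toℕ k ℕ.< p
    k<p {k} k≢p = ℕ.≤∧≢⇒< (ℕ.≤-pred (toℕ<n k)) (λ k≡p → k≢p (toℕ-injective (trans k≡p (sym (toℕ-fromℕ p)))))
    p∣F[k] : ∀ k → k ≢ fromℕ p → k ≢ zero → + p ∣ F k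
    p∣F[k] k k≢p k≢0 = subst (+ p ∣_) (sym (F≡term k))
      (∣m⇒∣m*n {m = + (p C toℕ k)} _ (∣ᵤ⇒∣ (prime∣binomial p-prime (0<k k≢0) (k<p k≢p))))

  -- (u + 1)ᵖ = zᵖ = 1, so Frobenius gives uᵖ + 1 ≡ 1 (mod p).
  p∣uᵖ : ∀ b → + p ∣ (u ^ p) b
  p∣uᵖ b = subst (+ p ∣_) (ℤ.neg-involutive ((u ^ p) b)) (∣m⇒∣-m (subst (+ p ∣_) frobenius≡-uᵖ (frobenius u 1ᴳ b)))
    where
    p-mod≡0 : p mod p ≡ 0ₚ
    p-mod≡0 = mod-cong (trans (n%n≡0 p) (sym (m<n⇒m%n≡m (ℕ.>-nonZero⁻¹ p))))
    [u⊞1]ᵖ≈1 : (u ⊞ 1ᴳ) ^ p ≈ 1ᴳ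
    [u⊞1]ᵖ≈1 b = trans (^-congˡ p u⊞1≈z b) (trans (z^ p b) (cong (λ c → δ c b) p-mod≡0))
    y-[x+y]≡-x : ∀ x y → y - (x + y) ≡ - x
    y-[x+y]≡-x = solve-∀
    frobenius≡-uᵖ : ((u ⊞ 1ᴳ) ^ p) b - ((u ^ p) b + (1ᴳ ^ p) b) ≡ - (u ^ p) b
    frobenius≡-uᵖ = trans (cong₂ (λ s t → s - ((u ^ p) b + t)) ([u⊞1]ᵖ≈1 b) (1ᴳ^ p b)) (y-[x+y]≡-x ((u ^ p) b) (1ᴳ b))

  p∣uᵃ : ∀ {a} → p ℕ.≤ a → ∀ b → + p ∣ (u ^ a) b
  p∣uᵃ {a} p≤a b = subst (+ p ∣_) (sym uᵃ≈uᵃ⁻ᵖuᵖ) (∣-⊛ (u ^ (a ∸ p)) (u ^ p) p∣uᵖ b)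
    where
    uᵃ≈uᵃ⁻ᵖuᵖ : (u ^ a) b ≡ (u ^ (a ∸ p) ⊛ u ^ p) b
    uᵃ≈uᵃ⁻ᵖuᵖ = trans (cong (λ n → (u ^ n) b) (sym (ℕ.m∸n+n≡m p≤a))) (^-homo-* u (a ∸ p) p b)

  -- u is prime in ℤ[ℤ/p]/ℤN ≅ ℤ[ζₚ], with residue map ε mod p: once uᵃ⁺ᵇ is cancelled,
  -- Euclid's lemma for ε raises one of the two valuations.
  u-adic-step : ∀ {S D a b} → S ⊛ D ∼ 0ᴳ → u^ a divides S → u^ b divides D →
                u^ suc a divides S ⊎ u^ suc b divides D
  u-adic-step {S} {D} {a} {b} SD∼0 (Y₁ , S∼uᵃY₁) (Y₂ , D∼uᵇY₂) =
    Sum.map (u^-divides-suc {a} S∼uᵃY₁) (u^-divides-suc {b} D∼uᵇY₂) (prime∣*⇒∣⊎∣ (ε Y₁) (ε Y₂) p-prime p∣εY₁εY₂)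
    where
    regroup : u ^ a ⊛ (u ^ b ⊛ (Y₁ ⊛ Y₂)) ≈ (u ^ a ⊛ Y₁) ⊛ (u ^ b ⊛ Y₂)
    regroup x = trans (⊛-cong {u ^ a} (λ _ → refl) (x∙yz≈y∙xz (u ^ b) Y₁ Y₂) x) (sym (*-assoc (u ^ a) Y₁ (u ^ b ⊛ Y₂) x))
    Y₁Y₂∼0 : Y₁ ⊛ Y₂ ∼ 0ᴳ
    Y₁Y₂∼0 = u^-cancel b _ (u^-cancel a _ (∼-trans (≈⇒∼ regroup) (∼-trans (∼-sym (⊛-cong-∼ S∼uᵃY₁ D∼uᵇY₂)) SD∼0)))
    p∣εY₁εY₂ : + p ∣ ε Y₁ * ε Y₂
    p∣εY₁εY₂ = subst (+ p ∣_) (ε-⊛ Y₁ Y₂) (ε-∼0⇒p∣ Y₁Y₂∼0)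

  u-adic-valuations : ∀ {S D} → S ⊛ D ∼ 0ᴳ → ∀ m →
                      ∃₂ λ a b → a ℕ.+ b ≡ m × u^ a divides S × u^ b divides D
  u-adic-valuations {S} {D} SD∼0 zero    = 0 , 0 , refl , u^0-divides S , u^0-divides D
  u-adic-valuations {S} {D} SD∼0 (suc m) = raise (u-adic-valuations SD∼0 m)
    where
    raise : ∃₂ (λ a b → a ℕ.+ b ≡ m × u^ a divides S × u^ b divides D) →
            ∃₂ (λ a b → a ℕ.+ b ≡ suc m × u^ a divides S × u^ b divides D)
    raise (a , b , a+b≡m , uᵃ∣S , uᵇ∣D) =
      [ (λ uᵃ⁺¹∣S → suc a , b , cong suc a+b≡m , uᵃ⁺¹∣S , uᵇ∣D)
      , (λ uᵇ⁺¹∣D → a , suc b , trans (ℕ.+-suc a b) (cong suc a+b≡m) , uᵃ∣S , uᵇ⁺¹∣D)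
      ]′ (u-adic-step {a = a} {b} SD∼0 uᵃ∣S uᵇ∣D)

  u^≥p-divides-trit⇒≈0 : ∀ {S a} → (∀ x → Trit (S x)) → S 0ₚ ≡ 0ℤ → p ℕ.≤ a → u^ a divides S → S ≈ 0ᴳ
  u^≥p-divides-trit⇒≈0 {S} {a} S-trit S0≡0 p≤a (Y , mk∼ c S≡uᵃY+c) x = prime∣trit⇒≡0 p-prime p∣Sx (S-trit x)
    where
    p∣uᵃY : ∀ b → + p ∣ (u ^ a ⊛ Y) b
    p∣uᵃY b = subst (+ p ∣_) (⊛-comm Y (u ^ a) b) (∣-⊛ Y (u ^ a) (p∣uᵃ p≤a) b)
    p∣c : + p ∣ c
    p∣c = ∣m+n∣m⇒∣n (subst (+ p ∣_) (trans (sym S0≡0) (S≡uᵃY+c 0ₚ)) (divides 0ℤ refl)) (p∣uᵃY 0ₚ)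
    p∣Sx : + p ∣ S x
    p∣Sx = subst (+ p ∣_) (sym (S≡uᵃY+c x)) (∣m∣n⇒∣m+n (p∣uᵃY x) p∣c)

  trit-⊛≈0⇒≈0⊎≈0 : ∀ {S D} → (∀ x → Trit (S x)) → (∀ x → Trit (D x)) → S 0ₚ ≡ 0ℤ → D 0ₚ ≡ 0ℤ →
                       S ⊛ D ≈ 0ᴳ → S ≈ 0ᴳ ⊎ D ≈ 0ᴳ
  trit-⊛≈0⇒≈0⊎≈0 {S} {D} S-trit D-trit S0≡0 D0≡0 SD≈0 = conclude (u-adic-valuations (≈⇒∼ SD≈0) (p ℕ.+ p))
    where
    conclude : ∃₂ (λ a b → a ℕ.+ b ≡ p ℕ.+ p × u^ a divides S × u^ b divides D) → S ≈ 0ᴳ ⊎ D ≈ 0ᴳ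
    conclude (a , b , a+b≡p+p , uᵃ∣S , uᵇ∣D) with p ℕ.≤? a
    ... | yes p≤a = inj₁ (u^≥p-divides-trit⇒≈0 {S} S-trit S0≡0 p≤a uᵃ∣S)
    ... | no  p≰a = inj₂ (u^≥p-divides-trit⇒≈0 {D} D-trit D0≡0 p≤b uᵇ∣D)
      where
      p≤b : p ℕ.≤ b
      p≤b = ℕ.≮⇒≥ (λ b<p → ℕ.<-irrefl a+b≡p+p (ℕ.+-mono-< (ℕ.≰⇒> p≰a) b<p))

  ⊛-square-root-unique-up-to-sign : ∀ f g → (∀ x → Trit (f x)) → (∀ x → Trit (g x)) →
    (∀ x → (f x ≡ 0ℤ) ⇔ (g x ≡ 0ℤ)) → f 0ₚ ≡ 0ℤ → f ⊛ f ≈ g ⊛ g →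
    (∀ x → f x ≡ g x) ⊎ (∀ x → f x ≡ - g x)
  ⊛-square-root-unique-up-to-sign f g f-trit g-trit f≡0⇔g≡0 f0≡0 ff≈gg =
    Sum.swap (Sum.map f≡-g f≡g (trit-⊛≈0⇒≈0⊎≈0 s-trit d-trit s0≡0 d0≡0 s⊛d≈0))
    where
    s d : ℤ[ℤ/p]
    s x = half (f x + g x)
    d x = half (f x - g x)
    halves : ∀ x → f x ≡ s x + d x × g x ≡ s x - d x × Trit (s x) × Trit (d x)
    halves x = sign-halves (f-trit x) (g-trit x) (f≡0⇔g≡0 x)
    f≈s⊞d : f ≈ s ⊞ d
    f≈s⊞d x = proj₁ (halves x)
    g≈s⊟d : g ≈ s ⊟ d
    g≈s⊟d x = proj₁ (proj₂ (halves x))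
    s-trit : ∀ x → Trit (s x)
    s-trit x = proj₁ (proj₂ (proj₂ (halves x)))
    d-trit : ∀ x → Trit (d x)
    d-trit x = proj₂ (proj₂ (proj₂ (halves x)))
    g0≡0 : g 0ₚ ≡ 0ℤ
    g0≡0 = Equivalence.to (f≡0⇔g≡0 0ₚ) f0≡0
    s0≡0 : s 0ₚ ≡ 0ℤ
    s0≡0 = cong₂ (λ a c → half (a + c)) f0≡0 g0≡0
    d0≡0 : d 0ₚ ≡ 0ℤ
    d0≡0 = cong₂ (λ a c → half (a - c)) f0≡0 g0≡0
    s⊛d≈0 : s ⊛ d ≈ 0ᴳ
    s⊛d≈0 = [S⊞D]²≈[S⊟D]²⇒S⊛D≈0 {s} {d} λ b →
      trans (sym (⊛-cong f≈s⊞d f≈s⊞d b)) (trans (ff≈gg b) (⊛-cong g≈s⊟d g≈s⊟d b))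
    f≡g : d ≈ 0ᴳ → ∀ x → f x ≡ g x
    f≡g d≈0 x = halves-d≡0⇒≡ {s = s x} {d x} (f≈s⊞d x) (g≈s⊟d x) (d≈0 x)
    f≡-g : s ≈ 0ᴳ → ∀ x → f x ≡ - g x
    f≡-g s≈0 x = halves-s≡0⇒≡- {s = s x} {d x} (f≈s⊞d x) (g≈s⊟d x) (s≈0 x)

module _ (p : ℕ) .{{_ : NonZero p}} where

  χ-trit : ∀ x → Trit (χ p x)
  χ-trit x with x ≟ zeroF p
  ... | yes _ = inj₁ refl
  ... | no  _ with isSquare? p x
  ...   | yes _ = inj₂ (inj₁ refl)
  ...   | no  _ = inj₂ (inj₂ refl)

  χ≡0⇔≡0 : ∀ x → (χ p x ≡ 0ℤ) ⇔ (x ≡ zeroF p)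
  χ≡0⇔≡0 x with x ≟ zeroF p
  ... | yes x≡0 = mk⇔ (λ _ → x≡0) (λ _ → refl)
  ... | no  x≢0 with isSquare? p x
  ...   | yes _ = mk⇔ (λ ()) (λ x≡0 → ⊥-elim (x≢0 x≡0))
  ...   | no  _ = mk⇔ (λ ()) (λ x≡0 → ⊥-elim (x≢0 x≡0))

lemma5p3 : (p : ℕ) (pp : Prime p) (f : Fin p → ℤ)
    → (∀ x → f x ≡ 0ℤ ⊎ f x ≡ 1ℤ ⊎ f x ≡ -1ℤ)
    → (∀ x → (f x ≡ 0ℤ) ⇔ (x ≡ zeroF p {{prime⇒nonZero pp}}))
    → (∀ b → _⋆_ p {{prime⇒nonZero pp}} f f b ≡ _⋆_ p {{prime⇒nonZero pp}} (χ p {{prime⇒nonZero pp}}) (χ p {{prime⇒nonZero pp}}) b)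
    → (∀ x → f x ≡ χ p {{prime⇒nonZero pp}} x) ⊎ (∀ x → f x ≡ - χ p {{prime⇒nonZero pp}} x)
lemma5p3 p pp f f-trit f≡0⇔x≡0 f⋆f≡χ⋆χ =
  ⊛-square-root-unique-up-to-sign pp f (χ p) f-trit (χ-trit p)
    (λ x → ⇔-trans (f≡0⇔x≡0 x) (⇔-sym (χ≡0⇔≡0 p x)))
    (Equivalence.from (f≡0⇔x≡0 (zeroF p)) refl)
    f⋆f≡χ⋆χ
  where instance _ = prime⇒nonZero pp
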